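{- The set of $\mathcal{P}$-positions of the game $\Gamma_5$ is exactly $P_5=P_{5,0}\cup P_{5,1}\cup P_{5,2}$.
   Context: The game $\Gamma_5$ (a variant of Wythoff's game) is a two-player impartial game whose positions are pairs $(x,y)\in\mathbb{Z}_{\ge0}^2$. From a position $(x,y)\notin T_5$, where $T_5=\{(x,y): x+y\le 5\}$, a move goes to any of: $(u,y)$ with $0\le u<x$; $(x,v)$ with $0\le v<y$; $(x-t,y-t)$ with $1\le t\le\min(x,y)$. Positions in $T_5$ have no moves. Players alternate; a player who cannot move loses (equivalently, the player who moves into $T_5$ wins). A $\mathcal{P}$-position is a position from which the previous player can force a win (equivalently, Grundy number $0$). Let $\sigma$ be the substitution on finite lists over $\{1,2\}$ acting letterwise by $\sigma(1)=2$, $\sigma(2)=2,1$. Let $C_1=(1,1,1,1,1)$ and $C_{i+1}=\sigma(C_i)$. Let $(c_n)_{n\in\mathbb{N}}$ be the infinite sequence obtained by concatenating $C_1, C_2, C_3, \dots$ in this order, and $d_n=c_n+1$. Define $a_n = 6+\sum_{i=1}^{n-1} c_i$ and $b_n=12+\sum_{i=1}^{n-1} d_i$ for $n\in\mathbb{N}$. Let $P_{5,0}=\{(x,y)\in\mathbb{Z}_{\ge0}^2: x+y\le5\}$, $P_{5,1}=\{(b_n,a_n):n\in\mathbb{N}\}$, $P_{5,2}=\{(a_n,b_n):n\in\mathbb{N}\}$. -}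

module Defs where

open import Data.Nat using (ℕ; zero; suc; _+_; _∸_; _≤_; _<_)
open import Data.List using (List; []; _∷_; _++_; concatMap; replicate)
open import Data.Product using (Σ; _×_; _,_)
open import Data.Sum using (_⊎_)
open import Relation.Binary.PropositionalEquality using (_≡_)

data Move : ℕ → ℕ → ℕ → ℕ → Set where
  horiz : ∀ {x y u} → 5 < x + y → u < x → Move x y u y
  vert  : ∀ {x y v} → 5 < x + y → v < y → Move x y x v
  diag  : ∀ {x y t} → 5 < x + y → 1 ≤ t → t ≤ x → t ≤ y →
          Move x y (x ∸ t) (y ∸ t)

data IsP (x y : ℕ) : Set
data IsN (x y : ℕ) : Set

data IsP x y where
  allToN : (∀ u v → Move x y u v → IsN u v) → IsP x y

data IsN x y where
  someToP : ∀ u v → Move x y u v → IsP u v → IsN x y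

data Letter : Set where
  one two : Letter

val : Letter → ℕ
val one = 1
val two = 2

σ : Letter → List Letter
σ one = two ∷ []
σ two = two ∷ one ∷ []

-- C i  (1-indexed: C 1 = (1,1,1,1,1), C (i+1) = σ(C i)); C 0 is unused
C : ℕ → List Letter
C zero = []
C (suc zero) = replicate 5 one
C (suc (suc i)) = concatMap σ (C (suc i))

prefixC : ℕ → List Letter
prefixC zero = []
prefixC (suc k) = prefixC k ++ C (suc k)

nth : List Letter → ℕ → ℕ
nth [] _ = 0
nth (l ∷ _) zero = val l
nth (_ ∷ ls) (suc n) = nth ls n

-- c n for n ≥ 1: the n-th letter of C₁C₂C₃⋯.  Since every C i has
-- length ≥ 5, the prefix C₁⋯C_n has length ≥ n, so this is the n-th
-- entry of the infinite concatenation.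
c : ℕ → ℕ
c n = nth (prefixC n) (n ∸ 1)

d : ℕ → ℕ
d n = suc (c n)

sumTo : (ℕ → ℕ) → ℕ → ℕ
sumTo f zero = 0
sumTo f (suc m) = sumTo f m + f (suc m)

a : ℕ → ℕ
a n = 6 + sumTo c (n ∸ 1)

b : ℕ → ℕ
b n = 12 + sumTo d (n ∸ 1)

P50 : ℕ → ℕ → Set
P50 x y = x + y ≤ 5

P51 : ℕ → ℕ → Set
P51 x y = Σ ℕ λ n → 1 ≤ n × x ≡ b n × y ≡ a n

P52 : ℕ → ℕ → Set
P52 x y = Σ ℕ λ n → 1 ≤ n × x ≡ a n × y ≡ b n

P5 : ℕ → ℕ → Set
P5 x y = P50 x y ⊎ P51 x y ⊎ P52 x y

{-# OPTIONS --safe #-}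
module Submission where

-- The word w = c₁c₂c₃⋯ is the fixed point w = 11111 σ(w).  Since σ ℓ has length
-- val ℓ and begins with 2, the letters 2 of w sit exactly at the positions a n,
-- and summing w over the blocks of σ(w) gives a (a n) = a n + n + 4, so that
-- b n = a (a n) + 1 falls strictly between a (a n) and a (a n + 1) = a (a n) + 2.
-- Together with b n = a n + n + 5 this makes {a n} and {b n} a partition of
-- {6, 7, …}, as for Wythoff pairs.  Hence a row, column or diagonal through a
-- point of P₅ outside T₅ meets P₅ only in that point, so no move stays inside
-- P₅, while every other position has a move into P₅; in a game whose moves
-- decrease x + y such a set is exactly the set of P-positions.

open import Data.Empty using (⊥-elim)
open import Data.List using (List; []; _∷_; _++_; concat; concatMap; replicate; length; take; map)
open import Data.List.Properties using (length-++; map-++; concat-++)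
open import Data.Nat using (ℕ; zero; suc; _+_; _∸_; _≤_; _<_; z≤n; s≤s; s≤s⁻¹; _≤?_)
open import Data.Nat.Induction using (<-wellFounded)
open import Data.Nat.ListAction using (sum)
open import Data.Nat.Properties
open import Algebra.Properties.CommutativeSemigroup +-commutativeSemigroup
  using (xy∙z≈xz∙y; x∙yz≈y∙xz; x∙yz≈z∙xy)
open import Data.Product using (∃; ∃₂; _×_; _,_; proj₁; proj₂)
open import Data.Sum using (_⊎_; inj₁; inj₂; [_,_]) renaming (map to ⊎-map)
open import Function using (id)
open import Function.Definitions using (Injective)
open import Induction.WellFounded using (Acc; acc)
open import Relation.Binary using (tri<; tri≈; tri>; _Preserves_⟶_)
open import Relation.Binary.PropositionalEquality
  using (_≡_; _≢_; refl; sym; trans; cong; cong₂; subst; subst₂; module ≡-Reasoning)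
open import Relation.Nullary using (¬_; yes; no)

open import Defs

sumTo-suc : ∀ f j → sumTo (λ n → suc (f n)) j ≡ sumTo f j + j
sumTo-suc f zero = refl
sumTo-suc f (suc j) = begin
  sumTo (λ n → suc (f n)) j + suc (f (suc j))   ≡⟨ cong (_+ suc (f (suc j))) (sumTo-suc f j) ⟩
  sumTo f j + j + suc (f (suc j))               ≡⟨ +-suc (sumTo f j + j) (f (suc j)) ⟩
  suc (sumTo f j + j + f (suc j))               ≡⟨ cong suc (xy∙z≈xz∙y (sumTo f j) j (f (suc j))) ⟩
  suc (sumTo f j + f (suc j) + j)               ≡⟨ +-suc (sumTo f (suc j)) j ⟨
  sumTo f (suc j) + suc j                       ∎
  where open ≡-Reasoning

sumTo-mono : ∀ f → sumTo f Preserves _≤_ ⟶ _≤_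
sumTo-mono f {y = zero} z≤n = ≤-refl
sumTo-mono f {m} {suc n} m≤1+n with m≤n⇒m<n∨m≡n m≤1+n
... | inj₂ refl = ≤-refl
... | inj₁ m<1+n = ≤-trans (sumTo-mono f (s≤s⁻¹ m<1+n)) (m≤m+n _ _)

sumTo-strictMono : ∀ f → (∀ n → 0 < f (suc n)) → sumTo f Preserves _<_ ⟶ _<_
sumTo-strictMono f f-pos {m} m<n = <-≤-trans (m<m+n (sumTo f m) (f-pos m)) (sumTo-mono f m<n)

strictMono⇒injective : ∀ {f : ℕ → ℕ} → f Preserves _<_ ⟶ _<_ → Injective _≡_ _≡_ f
strictMono⇒injective {f} f-mono {m} {n} fm≡fn with <-cmp m n
... | tri< m<n _ _ = ⊥-elim (<-irrefl fm≡fn (f-mono m<n))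
... | tri≈ _ m≡n _ = m≡n
... | tri> _ _ n<m = ⊥-elim (<-irrefl (sym fm≡fn) (f-mono n<m))

monotone-skips : ∀ {f : ℕ → ℕ} → f Preserves _≤_ ⟶ _≤_ →
                 ∀ {m x} → f m < x → x < f (suc m) → ∀ k → f k ≢ x
monotone-skips f-mono {m} fm<x x<fm+1 k fk≡x with k ≤? m
... | yes k≤m = <-irrefl fk≡x (≤-<-trans (f-mono k≤m) fm<x)
... | no k≰m = <-irrefl (sym fk≡x) (<-≤-trans x<fm+1 (f-mono (≰⇒> k≰m)))

σ* : List Letter → List Letter
σ* = concatMap σ

σ*-++ : ∀ L M → σ* (L ++ M) ≡ σ* L ++ σ* M
σ*-++ L M = trans (cong concat (map-++ σ L M)) (sym (concat-++ (map σ L) (map σ M)))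

length-σ*-≥ : ∀ L → length L ≤ length (σ* L)
length-σ*-≥ [] = z≤n
length-σ*-≥ (one ∷ L) = s≤s (length-σ*-≥ L)
length-σ*-≥ (two ∷ L) = s≤s (m≤n⇒m≤1+n (length-σ*-≥ L))

nth-++ˡ : ∀ L M {i} → i < length L → nth (L ++ M) i ≡ nth L i
nth-++ˡ (l ∷ L) M {zero} _ = refl
nth-++ˡ (l ∷ L) M {suc i} (s≤s i<L) = nth-++ˡ L M i<L

prefixSum : List Letter → ℕ → ℕ
prefixSum L j = sum (map val (take j L))

prefixSum-suc : ∀ L j → prefixSum L (suc j) ≡ prefixSum L j + nth L j
prefixSum-suc [] zero = refl
prefixSum-suc [] (suc j) = refl
prefixSum-suc (l ∷ L) zero = +-identityʳ (val l)
prefixSum-suc (l ∷ L) (suc j) = trans (cong (val l +_) (prefixSum-suc L j)) (sym (+-assoc (val l) _ _))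

-- σ ℓ has length val ℓ and begins with two, so σ* L is a sequence of blocks,
-- the j-th of which starts at position prefixSum L j.
σ*-two-at-block : ∀ L {j} → j < length L → nth (σ* L) (prefixSum L j) ≡ 2
σ*-two-at-block (one ∷ L) {zero} _ = refl
σ*-two-at-block (two ∷ L) {zero} _ = refl
σ*-two-at-block (one ∷ L) {suc j} (s≤s j<L) = σ*-two-at-block L j<L
σ*-two-at-block (two ∷ L) {suc j} (s≤s j<L) = σ*-two-at-block L j<L

σ*-two⇒block : ∀ L p → nth (σ* L) p ≡ 2 → ∃ λ j → j < length L × p ≡ prefixSum L j
σ*-two⇒block [] p ()
σ*-two⇒block (l ∷ L) zero _ = 0 , s≤s z≤n , refl
σ*-two⇒block (one ∷ L) (suc p) eq with σ*-two⇒block L p eq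
... | j , j<L , refl = suc j , s≤s j<L , refl
σ*-two⇒block (two ∷ L) (suc zero) ()
σ*-two⇒block (two ∷ L) (suc (suc p)) eq with σ*-two⇒block L p eq
... | j , j<L , refl = suc j , s≤s j<L , refl

prefixSum-σ*-at-block : ∀ L {j} → j ≤ length L → prefixSum (σ* L) (prefixSum L j) ≡ prefixSum L j + j
prefixSum-σ*-at-block L {zero} _ = refl
prefixSum-σ*-at-block (one ∷ L) {suc j} (s≤s j≤L) =
  cong (1 +_) (trans (cong suc (prefixSum-σ*-at-block L j≤L)) (sym (+-suc _ j)))
prefixSum-σ*-at-block (two ∷ L) {suc j} (s≤s j≤L) =
  cong (2 +_) (trans (cong suc (prefixSum-σ*-at-block L j≤L)) (sym (+-suc _ j)))

prefixSum-≥ : ∀ L {j} → j ≤ length L → j ≤ prefixSum L j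
prefixSum-≥ L {zero} _ = z≤n
prefixSum-≥ (one ∷ L) {suc j} (s≤s j≤L) = s≤s (prefixSum-≥ L j≤L)
prefixSum-≥ (two ∷ L) {suc j} (s≤s j≤L) = s≤s (m≤n⇒m≤1+n (prefixSum-≥ L j≤L))

prefixC-suc : ∀ k → prefixC (suc k) ≡ replicate 5 one ++ σ* (prefixC k)
prefixC-suc zero = refl
prefixC-suc (suc k) = begin
  prefixC (suc k) ++ C (suc (suc k))
    ≡⟨ cong (_++ σ* (C (suc k))) (prefixC-suc k) ⟩
  (replicate 5 one ++ σ* (prefixC k)) ++ σ* (C (suc k))
    ≡⟨ cong (replicate 5 one ++_) (σ*-++ (prefixC k) (C (suc k))) ⟨
  replicate 5 one ++ σ* (prefixC (suc k))
    ∎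
  where open ≡-Reasoning

length-prefixC-≥ : ∀ k → k ≤ length (prefixC k)
length-prefixC-≥ zero = z≤n
length-prefixC-≥ (suc k) = begin
  suc k                                    ≡⟨ +-comm 1 k ⟩
  k + 1                                    ≤⟨ +-mono-≤ (length-prefixC-≥ k) (C-nonempty k) ⟩
  length (prefixC k) + length (C (suc k))  ≡⟨ length-++ (prefixC k) ⟨
  length (prefixC (suc k))                 ∎
  where
  open ≤-Reasoning
  C-nonempty : ∀ k → 1 ≤ length (C (suc k))
  C-nonempty zero = s≤s z≤n
  C-nonempty (suc k) = ≤-trans (C-nonempty k) (length-σ*-≥ (C (suc k)))

c≡nth-prefixC : ∀ {i K} → i < K → c (suc i) ≡ nth (prefixC K) i
c≡nth-prefixC {i} {suc K} (s≤s i≤K) with m≤n⇒m<n∨m≡n i≤K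
... | inj₂ refl = refl
... | inj₁ i<K = trans (c≡nth-prefixC i<K)
  (sym (nth-++ˡ (prefixC K) (C (suc K)) (<-≤-trans i<K (length-prefixC-≥ K))))

sumTo-c≡prefixSum : ∀ {j K} → j ≤ K → sumTo c j ≡ prefixSum (prefixC K) j
sumTo-c≡prefixSum {zero} _ = refl
sumTo-c≡prefixSum {suc j} {K} j<K = begin
  sumTo c j + c (suc j)
    ≡⟨ cong₂ _+_ (sumTo-c≡prefixSum (<⇒≤ j<K)) (c≡nth-prefixC j<K) ⟩
  prefixSum (prefixC K) j + nth (prefixC K) j
    ≡⟨ prefixSum-suc (prefixC K) j ⟨
  prefixSum (prefixC K) (suc j)
    ∎
  where open ≡-Reasoning

c-shift : ∀ {i K} → 5 + i ≤ K → c (6 + i) ≡ nth (σ* (prefixC K)) i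
c-shift {i} {K} le = trans (c≡nth-prefixC (s≤s le)) (cong (λ L → nth L (5 + i)) (prefixC-suc K))

sumTo-c-shift : ∀ {i K} → 5 + i ≤ K → sumTo c (5 + i) ≡ 5 + prefixSum (σ* (prefixC K)) i
sumTo-c-shift {i} {K} le =
  trans (sumTo-c≡prefixSum (m≤n⇒m≤1+n le)) (cong (λ L → prefixSum L (5 + i)) (prefixC-suc K))

c-one-or-two : ∀ i → c (suc i) ≡ 1 ⊎ c (suc i) ≡ 2
c-one-or-two i = letter (prefixC (suc i)) (length-prefixC-≥ (suc i))
  where
  letter : ∀ L {i} → i < length L → nth L i ≡ 1 ⊎ nth L i ≡ 2
  letter (one ∷ L) {zero} _ = inj₁ refl
  letter (two ∷ L) {zero} _ = inj₂ refl
  letter (l ∷ L) {suc i} (s≤s i<L) = letter L i<L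

c-positive : ∀ n → 0 < c (suc n)
c-positive n with c-one-or-two n
... | inj₁ c≡1 = ≤-reflexive (sym c≡1)
... | inj₂ c≡2 = ≤-trans (s≤s z≤n) (≤-reflexive (sym c≡2))

c≡2⇒a : ∀ i → c (suc i) ≡ 2 → ∃ λ j → suc i ≡ a (suc j)
c≡2⇒a 0 ()
c≡2⇒a 1 ()
c≡2⇒a 2 ()
c≡2⇒a 3 ()
c≡2⇒a 4 ()
c≡2⇒a (suc (suc (suc (suc (suc p))))) c≡2
  with σ*-two⇒block (prefixC (5 + p)) p (trans (sym (c-shift {p} ≤-refl)) c≡2)
... | j , j<L , p≡ = j , cong (6 +_) (trans p≡ (sym (sumTo-c≡prefixSum j≤5+p)))
  where
  j≤5+p : j ≤ 5 + p
  j≤5+p = ≤-trans (prefixSum-≥ (prefixC (5 + p)) (<⇒≤ j<L))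
                  (≤-trans (≤-reflexive (sym p≡)) (m≤n+m p 5))

-- Any K this large would do: prefixC K then determines c up to position a (suc j).
module _ (j : ℕ) where
  private
    s = sumTo c j
    K = 5 + s + j
    L = prefixC K

    j<K : j < K
    j<K = m<n+m j (s≤s z≤n)

    5+s≤K : 5 + s ≤ K
    5+s≤K = m≤m+n (5 + s) j

    s≡ : s ≡ prefixSum L j
    s≡ = sumTo-c≡prefixSum (<⇒≤ j<K)

    j<L : j < length L
    j<L = <-≤-trans j<K (length-prefixC-≥ K)

  c-at-a : c (a (suc j)) ≡ 2
  c-at-a = begin
    c (6 + s)                   ≡⟨ c-shift 5+s≤K ⟩
    nth (σ* L) s                ≡⟨ cong (nth (σ* L)) s≡ ⟩
    nth (σ* L) (prefixSum L j)  ≡⟨ σ*-two-at-block L j<L ⟩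
    2                           ∎
    where open ≡-Reasoning

  b≡1+a∘a : b (suc j) ≡ suc (a (a (suc j)))
  b≡1+a∘a = begin
    12 + sumTo d j                          ≡⟨ cong (12 +_) (sumTo-suc c j) ⟩
    12 + (s + j)                            ≡⟨ cong (λ t → 12 + (t + j)) s≡ ⟩
    12 + (prefixSum L j + j)                ≡⟨ cong (12 +_) (prefixSum-σ*-at-block L (<⇒≤ j<L)) ⟨
    12 + prefixSum (σ* L) (prefixSum L j)   ≡⟨ cong (λ t → 12 + prefixSum (σ* L) t) s≡ ⟨
    12 + prefixSum (σ* L) s                 ≡⟨ cong (7 +_) (sumTo-c-shift 5+s≤K) ⟨
    7 + sumTo c (5 + s)                     ∎
    where open ≡-Reasoning

-- The sequences are 1-indexed: a 0 = a 1 and b 0 = b 1 are junk values, so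
-- indices are written suc j.
a-suc : ∀ j → a (suc (suc j)) ≡ c (suc j) + a (suc j)
a-suc j = x∙yz≈z∙xy 6 (sumTo c j) (c (suc j))

a-mono : a Preserves _≤_ ⟶ _≤_
a-mono m≤n = +-monoʳ-≤ 6 (sumTo-mono c (∸-monoˡ-≤ 1 m≤n))

a-strictMono : (λ j → a (suc j)) Preserves _<_ ⟶ _<_
a-strictMono i<j = +-monoʳ-< 6 (sumTo-strictMono c c-positive i<j)

5<a : ∀ n → 5 < a n
5<a n = m≤m+n 6 _

5<b : ∀ n → 5 < b n
5<b n = m≤m+n 6 _

b≡a+gap : ∀ j → b (suc j) ≡ a (suc j) + (5 + suc j)
b≡a+gap j = trans (cong (12 +_) (sumTo-suc c j)) (cong (6 +_) (sym (x∙yz≈y∙xz (sumTo c j) 6 j)))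

b-strictMono : (λ j → b (suc j)) Preserves _<_ ⟶ _<_
b-strictMono {i} {j} i<j = subst₂ _<_ (sym (b≡a+gap i)) (sym (b≡a+gap j))
  (+-mono-≤-< (a-mono (s≤s (<⇒≤ i<j))) (+-monoʳ-< 5 (s≤s i<j)))

a<b : ∀ j → a (suc j) < b (suc j)
a<b j = subst (a (suc j) <_) (sym (b≡a+gap j)) (m<m+n (a (suc j)) (s≤s z≤n))

a-injective : ∀ i j → a (suc i) ≡ a (suc j) → i ≡ j
a-injective i j = strictMono⇒injective a-strictMono

b-injective : ∀ i j → b (suc i) ≡ b (suc j) → i ≡ j
b-injective i j = strictMono⇒injective b-strictMono

a≢b : ∀ i j → a (suc i) ≢ b (suc j)
a≢b i j a≡b = monotone-skips a-mono {m} (n<1+n (a m)) am+1<am+2 (suc i) (trans a≡b (b≡1+a∘a j))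
  where
  m = a (suc j)
  am+1<am+2 : suc (a m) < a (suc m)
  am+1<am+2 = subst (suc (a m) <_) (sym (trans (a-suc (5 + sumTo c j)) (cong (_+ a m) (c-at-a j)))) ≤-refl

a-bracket : ∀ k → ∃ λ j → a (suc j) ≤ 6 + k × 6 + k < a (suc (suc j))
a-bracket zero = 0 , ≤-refl , a-strictMono {0} {1} (s≤s z≤n)
a-bracket (suc k) with a-bracket k
... | j , lo , hi with m≤n⇒m<n∨m≡n hi
...   | inj₁ lt = j , m≤n⇒m≤1+n lo , lt
...   | inj₂ eq =
  suc j , ≤-reflexive (sym eq) , subst (_< a (suc (suc (suc j)))) (sym eq) (a-strictMono (n<1+n (suc j)))

between-a : ∀ j {x} → a (suc j) < x → x < a (suc (suc j)) → x ≡ suc (a (suc j)) × c (suc j) ≡ 2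
between-a j {x} a<x x<a⁺ with c (suc j) | c-one-or-two j | subst (x <_) (a-suc j) x<a⁺
... | _ | inj₁ refl | x<1+a = ⊥-elim (<⇒≱ a<x (s≤s⁻¹ x<1+a))
... | _ | inj₂ refl | x<2+a = ≤-antisym (s≤s⁻¹ x<2+a) a<x , refl

between-a⇒b : ∀ j {x} → a (suc j) < x → x < a (suc (suc j)) → ∃ λ j′ → x ≡ b (suc j′)
between-a⇒b j a<x x<a⁺ with between-a j a<x x<a⁺
... | refl , c≡2 with c≡2⇒a j c≡2
...   | j′ , j+1≡a = j′ , trans (cong (λ t → suc (a t)) j+1≡a) (sym (b≡1+a∘a j′))

a-or-b : ∀ k → (∃ λ j → 6 + k ≡ a (suc j)) ⊎ (∃ λ j → 6 + k ≡ b (suc j))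
a-or-b k with a-bracket k
... | j , lo , hi with m≤n⇒m<n∨m≡n lo
...   | inj₂ a≡ = inj₁ (j , sym a≡)
...   | inj₁ a< = inj₂ (between-a⇒b j a< hi)

MovesInto : (ℕ → ℕ → Set) → ℕ → ℕ → Set
MovesInto S x y = ∃₂ λ u v → Move x y u v × S u v

Move-outside-T₅ : ∀ {x y u v} → Move x y u v → 5 < x + y
Move-outside-T₅ (horiz big _) = big
Move-outside-T₅ (vert big _) = big
Move-outside-T₅ (diag big _ _ _) = big

Move-decreasing : ∀ {x y u v} → Move x y u v → u + v < x + y
Move-decreasing (horiz {y = y} _ u<x) = +-monoˡ-< y u<x
Move-decreasing (vert {x = x} _ v<y) = +-monoʳ-< x v<y
Move-decreasing (diag {y = y} {t} _ 1≤t t≤x _) = +-mono-<-≤ (∸-monoʳ-< 1≤t t≤x) (m∸n≤m y t)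

Move-swap : ∀ {x y u v} → Move x y u v → Move y x v u
Move-swap (horiz {x} {y} big u<x) = vert (subst (5 <_) (+-comm x y) big) u<x
Move-swap (vert {x} {y} big v<y) = horiz (subst (5 <_) (+-comm x y) big) v<y
Move-swap (diag {x} {y} big 1≤t t≤x t≤y) = diag (subst (5 <_) (+-comm x y) big) 1≤t t≤y t≤x

Move-diagonal : ∀ {x g u} → 5 < x + (x + g) → u < x → Move x (x + g) u (u + g)
Move-diagonal {x} {g} {u} big u<x =
  subst₂ (Move x (x + g)) x∸t≡u y∸t≡u+g (diag big (m<n⇒0<n∸m u<x) t≤x (≤-trans t≤x (m≤m+n x g)))
  where
  t≤x : x ∸ u ≤ x
  t≤x = m∸n≤m x u
  x∸t≡u : x ∸ (x ∸ u) ≡ u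
  x∸t≡u = m∸[m∸n]≡n (<⇒≤ u<x)
  y∸t≡u+g : x + g ∸ (x ∸ u) ≡ u + g
  y∸t≡u+g = trans (+-∸-comm g t≤x) (cong (_+ g) x∸t≡u)

IsP⇒¬IsN : ∀ {x y} → IsP x y → ¬ IsN x y
IsP⇒¬IsN (allToN toN) (someToP u v mv p) = IsP⇒¬IsN p (toN u v mv)

module _ {S : ℕ → ℕ → Set}
         (independent : ∀ {x y u v} → S x y → Move x y u v → ¬ S u v)
         (absorbing : ∀ x y → S x y ⊎ MovesInto S x y) where

  private
    classify : ∀ x y → Acc _<_ (x + y) → (S x y → IsP x y) × (S x y ⊎ IsN x y)
    classify x y (acc rec) = S⇒IsP , S⊎IsN
      where
      IH : ∀ {u v} → Move x y u v → (S u v → IsP u v) × (S u v ⊎ IsN u v)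
      IH {u} {v} mv = classify u v (rec (Move-decreasing mv))

      S⇒IsP : S x y → IsP x y
      S⇒IsP s = allToN λ u v mv → [ (λ s′ → ⊥-elim (independent s mv s′)) , id ] (proj₂ (IH mv))

      S⊎IsN : S x y ⊎ IsN x y
      S⊎IsN with absorbing x y
      ... | inj₁ s = inj₁ s
      ... | inj₂ (u , v , mv , s) = inj₂ (someToP u v mv (proj₁ (IH mv) s))

  IsP⇔kernel : ∀ x y → (IsP x y → S x y) × (S x y → IsP x y)
  IsP⇔kernel x y with classify x y (<-wellFounded (x + y))
  ... | S⇒IsP , inj₁ s = (λ _ → s) , S⇒IsP
  ... | S⇒IsP , inj₂ n = (λ p → ⊥-elim (IsP⇒¬IsN p n)) , S⇒IsP

P5-swap : ∀ {x y} → P5 x y → P5 y x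
P5-swap {x} {y} (inj₁ small) = inj₁ (subst (_≤ 5) (+-comm x y) small)
P5-swap (inj₂ (inj₁ (n , 1≤n , x≡b , y≡a))) = inj₂ (inj₂ (n , 1≤n , y≡a , x≡b))
P5-swap (inj₂ (inj₂ (n , 1≤n , x≡a , y≡b))) = inj₂ (inj₁ (n , 1≤n , y≡b , x≡a))

P5-in-column-a : ∀ j {v} → P5 (a (suc j)) v → v ≡ b (suc j)
P5-in-column-a j {v} (inj₁ small) = ⊥-elim (<⇒≱ (5<a (suc j)) (≤-trans (m≤m+n (a (suc j)) v) small))
P5-in-column-a j (inj₂ (inj₁ (suc i , _ , a≡b , _))) = ⊥-elim (a≢b j i a≡b)
P5-in-column-a j (inj₂ (inj₂ (suc i , _ , a≡a , v≡b))) with a-injective j i a≡a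
... | refl = v≡b

P5-in-row-b : ∀ j {u} → P5 u (b (suc j)) → u ≡ a (suc j)
P5-in-row-b j {u} (inj₁ small) = ⊥-elim (<⇒≱ (5<b (suc j)) (≤-trans (m≤n+m (b (suc j)) u) small))
P5-in-row-b j (inj₂ (inj₁ (suc i , _ , _ , b≡a))) = ⊥-elim (a≢b i j (sym b≡a))
P5-in-row-b j (inj₂ (inj₂ (suc i , _ , u≡a , b≡b))) with b-injective j i b≡b
... | refl = u≡a

P5-on-gap : ∀ j {u} → P5 u (u + (5 + suc j)) → u ≡ a (suc j)
P5-on-gap j {u} (inj₁ small) =
  ⊥-elim (<⇒≱ (≤-trans (m≤m+n 6 j) (≤-trans (m≤n+m (6 + j) u) (m≤n+m _ u))) small)
P5-on-gap j {u} (inj₂ (inj₁ (suc i , _ , u≡b , v≡a))) =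
  ⊥-elim (<⇒≱ (a<b i) (subst₂ _≤_ u≡b v≡a (m≤m+n u (5 + suc j))))
P5-on-gap j {u} (inj₂ (inj₂ (suc i , _ , u≡a , v≡b)))
  with +-cancelˡ-≡ 6 j i (+-cancelˡ-≡ u _ _ u+gapⱼ≡u+gapᵢ)
  where
  u+gapⱼ≡u+gapᵢ : u + (5 + suc j) ≡ u + (5 + suc i)
  u+gapⱼ≡u+gapᵢ = trans v≡b (trans (b≡a+gap i) (cong (_+ (5 + suc i)) (sym u≡a)))
... | refl = u≡a

P52-independent : ∀ {x y u v} → P52 x y → Move x y u v → ¬ P5 u v
P52-independent (suc j , _ , refl , refl) (horiz _ u<x) p = <-irrefl (P5-in-row-b j p) u<x
P52-independent (suc j , _ , refl , refl) (vert _ v<y) p = <-irrefl (P5-in-column-a j p) v<y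
P52-independent (suc j , _ , refl , refl) (diag {t = t} _ 1≤t t≤x _) p =
  <-irrefl (P5-on-gap j (subst (P5 (a (suc j) ∸ t)) y∸t≡x∸t+gap p)) (∸-monoʳ-< 1≤t t≤x)
  where
  y∸t≡x∸t+gap : b (suc j) ∸ t ≡ a (suc j) ∸ t + (5 + suc j)
  y∸t≡x∸t+gap = trans (cong (_∸ t) (b≡a+gap j)) (+-∸-comm (5 + suc j) t≤x)

P5-independent : ∀ {x y u v} → P5 x y → Move x y u v → ¬ P5 u v
P5-independent (inj₁ small) mv _ = <⇒≱ (Move-outside-T₅ mv) small
P5-independent (inj₂ (inj₁ (n , 1≤n , x≡b , y≡a))) mv p =
  P52-independent (n , 1≤n , y≡a , x≡b) (Move-swap mv) (P5-swap p)
P5-independent (inj₂ (inj₂ p52)) = P52-independent p52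

≤5⊎6+ : ∀ n → n ≤ 5 ⊎ ∃ λ i → n ≡ 6 + i
≤5⊎6+ n with n ≤? 5
... | yes n≤5 = inj₁ n≤5
... | no n≰5 = inj₂ (n ∸ 6 , sym (m+[n∸m]≡n (≰⇒> n≰5)))

P5-on-gap-below : ∀ {g} j → g < 5 + suc j → ∃ λ u → u < a (suc j) × P5 u (u + g)
P5-on-gap-below {g} j g<gap with ≤5⊎6+ g
... | inj₁ g≤5 = 0 , s≤s z≤n , inj₁ g≤5
... | inj₂ (i , refl) = a (suc i) , a-strictMono (s≤s⁻¹ (+-cancelˡ-< 5 _ _ g<gap)) ,
                        inj₂ (inj₂ (suc i , s≤s z≤n , refl , sym (b≡a+gap i)))

P5-absorbing-from-a : ∀ j g → 5 < a (suc j) + (a (suc j) + g) →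
                      P5 (a (suc j)) (a (suc j) + g) ⊎ MovesInto P5 (a (suc j)) (a (suc j) + g)
P5-absorbing-from-a j g big with <-cmp g (5 + suc j)
... | tri≈ _ refl _ = inj₁ (inj₂ (inj₂ (suc j , s≤s z≤n , refl , sym (b≡a+gap j))))
... | tri> _ _ gap<g =
  inj₂ (a (suc j) , b (suc j) , vert big b<y , inj₂ (inj₂ (suc j , s≤s z≤n , refl , refl)))
  where
  b<y : b (suc j) < a (suc j) + g
  b<y = subst (_< a (suc j) + g) (sym (b≡a+gap j)) (+-monoʳ-< (a (suc j)) gap<g)
... | tri< g<gap _ _ with P5-on-gap-below j g<gap
...   | u , u<a , p = inj₂ (u , u + g , Move-diagonal big u<a , p)

P5-absorbing-outside-T₅ : ∀ x g → 5 < x + (x + g) → P5 x (x + g) ⊎ MovesInto P5 x (x + g)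
P5-absorbing-outside-T₅ x g big with ≤5⊎6+ x
... | inj₁ x≤5 = inj₂ (x , 5 ∸ x , vert big 5∸x<y , inj₁ (≤-reflexive (m+[n∸m]≡n x≤5)))
  where
  5∸x<y : 5 ∸ x < x + g
  5∸x<y = subst (_≤ x + g) (+-∸-assoc 1 x≤5) (m≤n+o⇒m∸n≤o 6 x big)
... | inj₂ (k , refl) with a-or-b k
...   | inj₁ (j , refl) = P5-absorbing-from-a j g big
...   | inj₂ (j , refl) =
  inj₂ (b (suc j) , a (suc j) , vert big (<-≤-trans (a<b j) (m≤m+n _ g)) ,
        inj₂ (inj₁ (suc j , s≤s z≤n , refl , refl)))

P5-absorbing-above-diagonal : ∀ x g → P5 x (x + g) ⊎ MovesInto P5 x (x + g)
P5-absorbing-above-diagonal x g with x + (x + g) ≤? 5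
... | yes small = inj₁ (inj₁ small)
... | no ¬small = P5-absorbing-outside-T₅ x g (≰⇒> ¬small)

P5-absorbing : ∀ x y → P5 x y ⊎ MovesInto P5 x y
P5-absorbing x y with ≤-total x y
... | inj₁ x≤y =
  subst (λ y → P5 x y ⊎ MovesInto P5 x y) (m+[n∸m]≡n x≤y) (P5-absorbing-above-diagonal x (y ∸ x))
... | inj₂ y≤x = ⊎-map P5-swap (λ { (u , v , mv , p) → v , u , Move-swap mv , P5-swap p })
  (subst (λ x → P5 y x ⊎ MovesInto P5 y x) (m+[n∸m]≡n y≤x) (P5-absorbing-above-diagonal y (x ∸ y)))

theorem4p9 : ∀ (x y : ℕ) → (IsP x y → P5 x y) × (P5 x y → IsP x y)
theorem4p9 = IsP⇔kernel P5-independent P5-absorbing
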